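{- Let $L$ be a finite set of vectors in $\{0,1\}^k$. Suppose $L$ has at least one HCO multiordering. Then every CO ordering of $L$ can be extended into an HCO multiordering of $L$. That is, one can insert additional columns, each equal to some element of $L$, between columns of the ordering, keeping the original columns in their original relative order, so that the resulting matrix is an HCO multiordering.
   Context: Let $L$ be a set of $n$ distinct vectors in $\{0,1\}^k$. - An ordering of $L$ is a $k\times n$ matrix whose columns form a permutation of $L$. - A multiordering of $L$ is a $k\times n'$ matrix, $n'\ge n$, all of whose columns lie in $L$ and in which every element of $L$ appears at least once as a column. - A $0$-$1$ matrix is CO if in every row the $1$'s (if any) form a single contiguous block. - Two columns $x,y$ are inharmonious if there are rows $i,j$ with $x_i=1,y_i=0,x_j=0,y_j=1$. - A matrix is HCO if it is CO and no two adjacent columns are inharmonious. -}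

module Defs where

open import Data.Bool using (Bool; true; false)
open import Data.Nat using (ℕ; _<_)
open import Data.Fin using (Fin)
open import Data.Vec using (Vec; lookup)
open import Data.List using (List; length; map)
open import Data.List.Relation.Unary.All using (All)
open import Data.List.Relation.Unary.Unique.Propositional using (Unique)
open import Data.List.Relation.Unary.Linked using (Linked)
open import Data.List.Relation.Binary.Permutation.Propositional using (_↭_)
open import Data.List.Membership.Propositional using (_∈_)
open import Data.Product using (_×_; Σ; ∃)
open import Relation.Binary.PropositionalEquality using (_≡_)
open import Relation.Nullary using (¬_)

-- A column is a vector in {0,1}^k; true = 1, false = 0.
Column : ℕ → Set
Column k = Vec Bool k

-- A k × n matrix is represented as the list of its n columns (left to right).
Matrix : ℕ → Set
Matrix k = List (Column k)

open import Data.List using () renaming (lookup to lookupL)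
open import Data.Fin using (toℕ)

row : ∀ {k} → Fin k → Matrix k → List Bool
row i M = map (λ c → lookup c i) M

Contiguous : List Bool → Set
Contiguous r = (a b c : Fin (length r)) → toℕ a < toℕ b → toℕ b < toℕ c →
  lookupL r a ≡ true → lookupL r c ≡ true → lookupL r b ≡ true

CO : ∀ {k} → Matrix k → Set
CO {k} M = (i : Fin k) → Contiguous (row i M)

Inharmonious : ∀ {k} → Column k → Column k → Set
Inharmonious {k} x y = Σ (Fin k) λ i → Σ (Fin k) λ j →
  (lookup x i ≡ true) × (lookup y i ≡ false) × (lookup x j ≡ false) × (lookup y j ≡ true)

HCO : ∀ {k} → Matrix k → Set
HCO M = CO M × Linked (λ x y → ¬ Inharmonious x y) M

-- L is a set of distinct vectors, represented as a duplicate-free list.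
-- An ordering of L: columns form a permutation of L.
IsOrdering : ∀ {k} → List (Column k) → Matrix k → Set
IsOrdering L M = M ↭ L

IsMultiordering : ∀ {k} → List (Column k) → Matrix k → Set
IsMultiordering L M = All (_∈ L) M × All (_∈ M) L

-- Write x ⊓ y (in the code: meet x y) for the coordinatewise minimum of two
-- columns.  The extension inserts x ⊓ y between every pair of adjacent
-- columns x, y of P.
-- Whatever P is, the result has harmonious neighbours (x ⊓ y lies below both
-- x and y) and it is CO again if P is (inserting a ∧ b between the bits a, b
-- of a row cannot break a block of 1's).  The only real work is to show that
-- the inserted columns lie in L.  Cut P between x and y into a prefix A ∋ x
-- and a suffix B ∋ y.  Walking in M₀ from x to y we meet an adjacent pair
-- z, z' of M₀ with one column in A and the other in B.  Contiguity of the
-- rows of M₀ across the cut at z|z' gives x ⊓ y ⊑ z ⊓ z', contiguity of the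
-- rows of P across the cut at x|y gives z ⊓ z' ⊑ x ⊓ y, so x ⊓ y = z ⊓ z';
-- and z, z' are harmonious, hence comparable, so z ⊓ z' ∈ {z, z'} ⊆ L.
module Submission where

open import Defs
open import Data.Bool using (Bool; true; false; _∧_)
open import Data.Bool.Properties using (∧-comm; ¬-not) renaming (_≟_ to _≟ᵇ_)
open import Data.Nat using (ℕ; _<_; s≤s; z≤n)
open import Data.Fin using (Fin; toℕ) renaming (zero to fzero; suc to fsuc)
open import Data.Fin.Properties using (all?; ¬∀⟶∃¬)
open import Data.Vec using (lookup; zipWith; []; _∷_)
open import Data.Vec.Properties using (lookup-zipWith; zipWith-comm; ≡-dec)
open import Data.List using (List; []; _∷_; _++_; map; length) renaming (lookup to lookupL)
open import Data.List.Properties using (map-++; ++-assoc)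
open import Data.List.Relation.Unary.All as All using (All; []; _∷_)
open import Data.List.Relation.Unary.Any using (here; there)
open import Data.List.Relation.Unary.AllPairs using (_∷_)
open import Data.List.Relation.Unary.Linked as Linked using (Linked; []; [-]; _∷_)
open import Data.List.Relation.Unary.Unique.Propositional using (Unique)
open import Data.List.Relation.Binary.Sublist.Propositional using (_⊆_; []; _∷_; _∷ʳ_)
import Data.List.Relation.Binary.Sublist.Propositional as Sublist
open import Data.List.Relation.Binary.Permutation.Propositional using (_↭_; ↭-sym; ↭⇒↭ₛ)
open import Data.List.Relation.Binary.Permutation.Propositional.Properties using (∈-resp-↭)
open import Data.List.Relation.Binary.Permutation.Setoid.Properties using (Unique-resp-↭)
open import Data.List.Membership.Propositional using (_∈_; _∉_)
open import Data.List.Membership.Propositional.Properties using (∈-map⁺; ∈-++⁺ʳ; ∈-++⁻; ∈-lookup)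
import Data.List.Membership.DecPropositional as DecMembership
open import Data.Product using (Σ; _×_; _,_; proj₁; proj₂)
open import Data.Sum using (_⊎_; inj₁; inj₂; [_,_])
import Data.Sum as Sum
open import Data.Empty using (⊥-elim)
open import Relation.Nullary using (¬_; Dec; yes; no; does)
open import Relation.Nullary.Decidable using (_→-dec_; dec-true; dec-false)
open import Relation.Binary.PropositionalEquality
  using (_≡_; _≢_; refl; sym; trans; cong; cong₂; subst; setoid)

∧-true⁻ : ∀ {a b} → a ∧ b ≡ true → a ≡ true × b ≡ true
∧-true⁻ {true} {true} _ = refl , refl

∧-true⁺ : ∀ {a b} → a ≡ true → b ≡ true → a ∧ b ≡ true
∧-true⁺ refl refl = refl

true≢false : true ≢ false
true≢false ()

no-true : ∀ {r} → All (_≡ false) r → true ∉ r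
no-true all t∈r = true≢false (All.lookup all t∈r)

all-false : ∀ (r : List Bool) → (∀ j → lookupL r j ≢ true) → All (_≡ false) r
all-false [] _ = []
all-false (b ∷ r) h = ¬-not (h fzero) ∷ all-false r (λ j → h (fsuc j))

-- A row of the shape 1…1 0…0.
data Block : List Bool → Set where
  zeros : ∀ {r} → All (_≡ false) r → Block r
  one   : ∀ {r} → Block r → Block (true ∷ r)

-- A row of the shape 0…0 1…1 0…0: leading 0's, then (possibly) a Block.
data Interval : List Bool → Set where
  []    : Interval []
  skip  : ∀ {r} → Interval r → Interval (false ∷ r)
  start : ∀ {r} → Block r → Interval (true ∷ r)

block-prefix : ∀ {r} → Block r → (b c : Fin (length r)) → toℕ b < toℕ c →
  lookupL r c ≡ true → lookupL r b ≡ true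
block-prefix {r} (zeros all) _ c _ e = ⊥-elim (no-true all (subst (_∈ r) e (∈-lookup c)))
block-prefix (one β) fzero _ _ _ = refl
block-prefix (one β) (fsuc b) (fsuc c) (s≤s b<c) e = block-prefix β b c b<c e

block⇒interval : ∀ {r} → Block r → Interval r
block⇒interval (zeros []) = []
block⇒interval (zeros (refl ∷ all)) = skip (block⇒interval (zeros all))
block⇒interval (one β) = start β

interval⇒contiguous : ∀ r → Interval r → Contiguous r
interval⇒contiguous [] [] ()
interval⇒contiguous (false ∷ r) (skip ι) fzero _ _ _ _ () _
interval⇒contiguous (false ∷ r) (skip ι) (fsuc a) (fsuc b) (fsuc c) (s≤s a<b) (s≤s b<c) =
  interval⇒contiguous r ι a b c a<b b<c
interval⇒contiguous (true ∷ r) (start β) fzero (fsuc b) (fsuc c) _ (s≤s b<c) _ =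
  block-prefix β b c b<c
interval⇒contiguous (true ∷ r) (start β) (fsuc a) (fsuc b) (fsuc c) (s≤s a<b) (s≤s b<c) =
  interval⇒contiguous r (block⇒interval β) a b c a<b b<c

contiguous-tail : ∀ {b r} → Contiguous (b ∷ r) → Contiguous r
contiguous-tail h a b c a<b b<c = h (fsuc a) (fsuc b) (fsuc c) (s≤s a<b) (s≤s b<c)

contiguous-drop₂ : ∀ {r} → Contiguous (true ∷ true ∷ r) → Contiguous (true ∷ r)
contiguous-drop₂ h fzero b c _ b<c = h fzero (fsuc b) (fsuc c) (s≤s z≤n) (s≤s b<c)
contiguous-drop₂ h (fsuc a) b c a<b b<c = h (fsuc (fsuc a)) (fsuc b) (fsuc c) (s≤s a<b) (s≤s b<c)

contiguous⇒block : ∀ r → Contiguous (true ∷ r) → Block r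
contiguous⇒block [] _ = zeros []
contiguous⇒block (true ∷ r) h = one (contiguous⇒block r (contiguous-drop₂ h))
contiguous⇒block (false ∷ r) h = zeros (refl ∷ all-false r gap)
  where
  gap : ∀ j → lookupL r j ≢ true
  gap j e with h fzero (fsuc fzero) (fsuc (fsuc j)) (s≤s z≤n) (s≤s (s≤s z≤n)) refl e
  ... | ()

-- ... and conversely; CO is thus a statement about the shapes of the rows.
contiguous⇒interval : ∀ r → Contiguous r → Interval r
contiguous⇒interval [] _ = []
contiguous⇒interval (false ∷ r) h = skip (contiguous⇒interval r (contiguous-tail h))
contiguous⇒interval (true ∷ r) h = start (contiguous⇒block r h)

block-head : ∀ {b r} → Block (b ∷ r) → true ∈ b ∷ r → b ≡ true
block-head (one _) _ = refl
block-head (zeros all) t = ⊥-elim (no-true all t)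

block-cut : ∀ s {b b' r} → Block (s ++ b ∷ b' ∷ r) → true ∈ b' ∷ r → b ≡ true × b' ≡ true
block-cut [] (one β) t = refl , block-head β t
block-cut [] (zeros (_ ∷ all)) t = ⊥-elim (no-true all t)
block-cut (_ ∷ s) (one β) t = block-cut s β t
block-cut (_ ∷ s) (zeros (_ ∷ all)) t = block-cut s (zeros all) t

interval-cut : ∀ s {b b' r} → Interval (s ++ b ∷ b' ∷ r) →
  true ∈ s ++ b ∷ [] → true ∈ b' ∷ r → b ≡ true × b' ≡ true
interval-cut [] (start β) _ t = refl , block-head β t
interval-cut [] (skip _) (here ()) _
interval-cut (true ∷ s) (start β) _ t = block-cut s β t
interval-cut (false ∷ s) (skip ι) (there t₁) t = interval-cut s ι t₁ t

_⊑_ : ∀ {k} → Column k → Column k → Set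
u ⊑ v = ∀ i → lookup u i ≡ true → lookup v i ≡ true

meet : ∀ {k} → Column k → Column k → Column k
meet = zipWith _∧_

lookup-meet : ∀ {k} (u v : Column k) i → lookup (meet u v) i ≡ lookup u i ∧ lookup v i
lookup-meet u v i = lookup-zipWith _∧_ i u v

meet-comm : ∀ {k} (u v : Column k) → meet u v ≡ meet v u
meet-comm = zipWith-comm ∧-comm

meet-⊑ˡ : ∀ {k} (u v : Column k) → meet u v ⊑ u
meet-⊑ˡ u v i e = proj₁ (∧-true⁻ (trans (sym (lookup-meet u v i)) e))

meet-⊑ʳ : ∀ {k} (u v : Column k) → meet u v ⊑ v
meet-⊑ʳ u v i e = proj₂ (∧-true⁻ (trans (sym (lookup-meet u v i)) e))

⊑-meet : ∀ {k} {w : Column k} u v → w ⊑ u → w ⊑ v → w ⊑ meet u v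
⊑-meet u v w⊑u w⊑v i e = trans (lookup-meet u v i) (∧-true⁺ (w⊑u i e) (w⊑v i e))

⊑-antisym : ∀ {k} {u v : Column k} → u ⊑ v → v ⊑ u → u ≡ v
⊑-antisym {u = []} {[]} _ _ = refl
⊑-antisym {u = a ∷ u} {b ∷ v} u⊑v v⊑u =
  cong₂ _∷_ (bits (u⊑v fzero) (v⊑u fzero)) (⊑-antisym (λ i → u⊑v (fsuc i)) (λ i → v⊑u (fsuc i)))
  where
  bits : ∀ {a b} → (a ≡ true → b ≡ true) → (b ≡ true → a ≡ true) → a ≡ b
  bits {true} a⇒b _ = sym (a⇒b refl)
  bits {false} {true} _ b⇒a = b⇒a refl
  bits {false} {false} _ _ = refl

⊑⇒meet≡ : ∀ {k} (u v : Column k) → u ⊑ v → meet u v ≡ u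
⊑⇒meet≡ u v u⊑v = ⊑-antisym (meet-⊑ˡ u v) (⊑-meet {w = u} u v (λ _ e → e) u⊑v)

comparable⇒harmonious : ∀ {k} (u v : Column k) → u ⊑ v ⊎ v ⊑ u → ¬ Inharmonious u v
comparable⇒harmonious _ _ (inj₁ u⊑v) (i , _ , uᵢ , vᵢ , _ , _) = true≢false (trans (sym (u⊑v i uᵢ)) vᵢ)
comparable⇒harmonious _ _ (inj₂ v⊑u) (_ , j , _ , _ , uⱼ , vⱼ) = true≢false (trans (sym (v⊑u j vⱼ)) uⱼ)

⊑-at? : ∀ {k} (u v : Column k) i → Dec (lookup u i ≡ true → lookup v i ≡ true)
⊑-at? u v i = (lookup u i ≟ᵇ true) →-dec (lookup v i ≟ᵇ true)

-- Conversely, harmonious columns are comparable: a coordinate witnessing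
-- u ⋢ v rules out every coordinate witnessing v ⋢ u.
harmonious⇒comparable : ∀ {k} {u v : Column k} → ¬ Inharmonious u v → u ⊑ v ⊎ v ⊑ u
harmonious⇒comparable {k} {u} {v} harmonious with all? (⊑-at? u v)
... | yes u⊑v = inj₁ u⊑v
... | no u⋢v with ¬∀⟶∃¬ k _ (⊑-at? u v) u⋢v
...   | i , ¬uᵢ⇒vᵢ = inj₂ v⊑u
  where
  uᵢ : lookup u i ≡ true
  uᵢ with lookup u i ≟ᵇ true
  ... | yes e = e
  ... | no n = ⊥-elim (¬uᵢ⇒vᵢ (λ e → ⊥-elim (n e)))
  vᵢ : lookup v i ≡ false
  vᵢ = ¬-not (λ e → ¬uᵢ⇒vᵢ (λ _ → e))
  v⊑u : v ⊑ u
  v⊑u j vⱼ with lookup u j ≟ᵇ true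
  ... | yes uⱼ = uⱼ
  ... | no uⱼ = ⊥-elim (harmonious (i , j , uᵢ , vᵢ , ¬-not uⱼ , vⱼ))

-- The meet of two harmonious columns of L lies in L: it is one of them.
harmonious-meet-∈ : ∀ {k} {L : Matrix k} {u v} → u ∈ L → v ∈ L → ¬ Inharmonious u v → meet u v ∈ L
harmonious-meet-∈ {u = u} {v} u∈L v∈L harmonious with harmonious⇒comparable {u = u} {v} harmonious
... | inj₁ u⊑v = subst (_∈ _) (sym (⊑⇒meet≡ u v u⊑v)) u∈L
... | inj₂ v⊑u = subst (_∈ _) (sym (trans (meet-comm u v) (⊑⇒meet≡ v u v⊑u))) v∈L

module _ {A : Set} (_⊓_ : A → A → A) where

  meetsAfter : A → List A → List A
  meetsAfter x [] = []
  meetsAfter x (y ∷ M) = x ⊓ y ∷ y ∷ meetsAfter y M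

  insertMeets : List A → List A
  insertMeets [] = []
  insertMeets (x ∷ M) = x ∷ meetsAfter x M

  ⊆-insertMeets : ∀ M → M ⊆ insertMeets M
  ⊆-insertMeets [] = []
  ⊆-insertMeets (x ∷ M) = refl ∷ after x M
    where
    after : ∀ x M → M ⊆ meetsAfter x M
    after x [] = []
    after x (y ∷ M) = (x ⊓ y) ∷ʳ (refl ∷ after y M)

  All-insertMeets : ∀ {P : A → Set} {M} → All P M → Linked (λ x y → P (x ⊓ y)) M →
    All P (insertMeets M)
  All-insertMeets [] _ = []
  All-insertMeets (px ∷ pM) adjacent = px ∷ after pM adjacent
    where
    after : ∀ {P : A → Set} {x M} → All P M → Linked (λ x y → P (x ⊓ y)) (x ∷ M) →
      All P (meetsAfter x M)
    after [] _ = []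
    after (py ∷ pM) (pxy ∷ adjacent) = pxy ∷ py ∷ after pM adjacent

  Linked-insertMeets : ∀ {R : A → A → Set} → (∀ x y → R x (x ⊓ y)) → (∀ x y → R (x ⊓ y) y) →
    ∀ M → Linked R (insertMeets M)
  Linked-insertMeets {R} left right [] = []
  Linked-insertMeets {R} left right (x ∷ M) = after x M
    where
    after : ∀ x M → Linked R (x ∷ meetsAfter x M)
    after x [] = [-]
    after x (y ∷ M) = left x y ∷ right x y ∷ after y M

map-insertMeets : ∀ {A B : Set} {_⊓_ : A → A → A} {_⊙_ : B → B → B} (f : A → B) →
  (∀ x y → f (x ⊓ y) ≡ f x ⊙ f y) → ∀ M → map f (insertMeets _⊓_ M) ≡ insertMeets _⊙_ (map f M)
map-insertMeets {_⊓_ = _⊓_} {_⊙_} f hom [] = refl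
map-insertMeets {_⊓_ = _⊓_} {_⊙_} f hom (x ∷ M) = cong (f x ∷_) (after x M)
  where
  after : ∀ x M → map f (meetsAfter _⊓_ x M) ≡ meetsAfter _⊙_ (f x) (map f M)
  after x [] = refl
  after x (y ∷ M) = cong₂ (λ m r → m ∷ f y ∷ r) (hom x y) (after y M)

zeros-after : ∀ {r} → All (_≡ false) r → All (_≡ false) (meetsAfter _∧_ false r)
zeros-after [] = []
zeros-after (refl ∷ all) = refl ∷ refl ∷ zeros-after all

block-after : ∀ {r} → Block r → Block (meetsAfter _∧_ true r)
block-after {[]} _ = zeros []
block-after {_ ∷ _} (one β) = one (one (block-after β))
block-after {_ ∷ _} (zeros (refl ∷ all)) = zeros (refl ∷ refl ∷ zeros-after all)

interval-after : ∀ {b r} → Interval (b ∷ r) → Interval (b ∷ meetsAfter _∧_ b r)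
interval-after {r = []} ι = ι
interval-after {r = _ ∷ _} (skip ι) = skip (skip (interval-after ι))
interval-after {r = _ ∷ _} (start β) = start (block-after β)

Interval-insertMeets : ∀ {r} → Interval r → Interval (insertMeets _∧_ r)
Interval-insertMeets [] = []
Interval-insertMeets (skip ι) = interval-after (skip ι)
Interval-insertMeets (start β) = interval-after (start β)

linked-at : ∀ {A : Set} {R : A → A → Set} (T₁ : List A) {z z' T₂} →
  Linked R (T₁ ++ z ∷ z' ∷ T₂) → R z z'
linked-at [] linked = Linked.head linked
linked-at (_ ∷ T₁) linked = linked-at T₁ (Linked.tail linked)

linked-from-splits : ∀ {A : Set} {R : A → A → Set} (M : List A) →
  (∀ S₁ {x y} S₂ → M ≡ S₁ ++ x ∷ y ∷ S₂ → R x y) → Linked R M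
linked-from-splits [] _ = []
linked-from-splits (x ∷ []) _ = [-]
linked-from-splits (x ∷ y ∷ M) at =
  at [] M refl ∷ linked-from-splits (y ∷ M) (λ S₁ S₂ eq → at (x ∷ S₁) S₂ (cong (x ∷_) eq))

unique-disjoint : ∀ {A : Set} (xs : List A) {ys w} → Unique (xs ++ ys) → w ∈ xs → w ∉ ys
unique-disjoint (x ∷ xs) (x∉ ∷ _) (here refl) w∈ys = All.lookup x∉ (∈-++⁺ʳ xs w∈ys) refl
unique-disjoint (x ∷ xs) (_ ∷ unique) (there w∈xs) = unique-disjoint xs unique w∈xs

record Crossing {A : Set} (side : A → Bool) (M : List A) (a b : A) : Set where
  constructor crossing
  field
    T₁ : List A
    z z' : A
    T₂ : List A
    split : M ≡ T₁ ++ z ∷ z' ∷ T₂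
    before : a ∈ T₁ ++ z ∷ []
    after : b ∈ z' ∷ T₂
    changes : side z ≢ side z'

module _ {A : Set} (side : A → Bool) where

  crossing-cons : ∀ {M a b} m → Crossing side M a b → Crossing side (m ∷ M) a b
  crossing-cons m (crossing T₁ z z' T₂ split before after changes) =
    crossing (m ∷ T₁) z z' T₂ (cong (m ∷_) split) (there before) after changes

  walk : ∀ m M {b} → b ∈ M → side m ≢ side b → Crossing side (m ∷ M) m b
  walk m (w ∷ M) b∈ m≢b with side m ≟ᵇ side w
  ... | no m≢w = crossing [] m w M refl (here refl) b∈ m≢w
  ... | yes m≡w with b∈
  ...   | here refl = ⊥-elim (m≢b m≡w)
  ...   | there b∈M with walk w M b∈M (λ w≡b → m≢b (trans m≡w w≡b))
  ...     | crossing T₁ z z' T₂ split _ after changes =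
              crossing (m ∷ T₁) z z' T₂ (cong (m ∷_) split) (here refl) after changes

  find-crossing : ∀ {M a b} → a ∈ M → b ∈ M → side a ≢ side b →
    Crossing side M a b ⊎ Crossing side M b a
  find-crossing (here refl) (here refl) a≢b = ⊥-elim (a≢b refl)
  find-crossing {_ ∷ M} (here refl) (there b∈M) a≢b = inj₁ (walk _ M b∈M a≢b)
  find-crossing {_ ∷ M} (there a∈M) (here refl) a≢b = inj₂ (walk _ M a∈M (λ e → a≢b (sym e)))
  find-crossing (there a∈M) (there b∈M) a≢b =
    Sum.map (crossing-cons _) (crossing-cons _) (find-crossing a∈M b∈M a≢b)

true-in-row : ∀ {k} i {a : Column k} {T} → a ∈ T → lookup a i ≡ true → true ∈ row i T
true-in-row i {T = T} a∈T e = subst (_∈ row i T) e (∈-map⁺ (λ c → lookup c i) a∈T)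

cut-meet : ∀ {k} (T₁ : Matrix k) {z z' : Column k} {T₂ a b} → CO (T₁ ++ z ∷ z' ∷ T₂) →
  a ∈ T₁ ++ z ∷ [] → b ∈ z' ∷ T₂ → meet a b ⊑ meet z z'
cut-meet T₁ {z} {z'} {T₂} {a} {b} co a∈ b∈ i e =
  trans (lookup-meet z z' i) (∧-true⁺ (proj₁ zᵢ×z'ᵢ) (proj₂ zᵢ×z'ᵢ))
  where
  entry : Column _ → Bool
  entry c = lookup c i
  rowᵢ : Interval (row i T₁ ++ entry z ∷ entry z' ∷ row i T₂)
  rowᵢ = subst Interval (map-++ entry T₁ (z ∷ z' ∷ T₂)) (contiguous⇒interval _ (co i))
  true-before : true ∈ row i T₁ ++ entry z ∷ []
  true-before = subst (true ∈_) (map-++ entry T₁ (z ∷ [])) (true-in-row i a∈ (meet-⊑ˡ a b i e))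
  zᵢ×z'ᵢ : entry z ≡ true × entry z' ≡ true
  zᵢ×z'ᵢ = interval-cut (row i T₁) rowᵢ true-before (true-in-row i b∈ (meet-⊑ʳ a b i e))

-- Cut the duplicate-free CO ordering P between adjacent x, y into A ∋ x and
-- B ∋ y.  A crossing of M₀ from A to B at z, z' gives meet x y ⊑ meet z z'
-- (cut lemma in M₀) and meet z z' ⊑ meet x y (cut lemma in P); as z, z' are
-- harmonious, meet z z' is z or z'.
adjacent-meet-∈ : ∀ {k} {L M₀ P : Matrix k} → IsMultiordering L M₀ → HCO M₀ →
  P ↭ L → Unique P → CO P → ∀ S₁ {x y} S₂ → P ≡ S₁ ++ x ∷ y ∷ S₂ → meet x y ∈ L
adjacent-meet-∈ {k} {L} {M₀} (M₀⊆L , L⊆M₀) (M₀-co , M₀-harmonious) P↭L uniqueP coP S₁ {x} {y} S₂ refl =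
  [ (λ c → via c refl) , (λ c → via c (meet-comm y x)) ] (find-crossing side (in-M₀ x∈P) (in-M₀ y∈P) x≢y)
  where
  open DecMembership (≡-dec _≟ᵇ_) using (_∈?_)
  A B : Matrix k
  A = S₁ ++ x ∷ []
  B = y ∷ S₂
  P≡A++B : S₁ ++ x ∷ y ∷ S₂ ≡ A ++ B
  P≡A++B = sym (++-assoc S₁ (x ∷ []) B)

  side : Column k → Bool
  side w = does (w ∈? A)

  in-A : ∀ {w} → side w ≡ true → w ∈ A
  in-A {w} s with w ∈? A
  ... | yes w∈A = w∈A
  ... | no _ = ⊥-elim (true≢false (sym s))

  in-B : ∀ {w} → w ∈ L → side w ≡ false → w ∈ B
  in-B {w} w∈L s with ∈-++⁻ A (subst (w ∈_) P≡A++B (∈-resp-↭ (↭-sym P↭L) w∈L))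
  ... | inj₁ w∈A = ⊥-elim (true≢false (trans (sym (dec-true (w ∈? A) w∈A)) s))
  ... | inj₂ w∈B = w∈B

  x∈P : x ∈ S₁ ++ x ∷ y ∷ S₂
  x∈P = ∈-++⁺ʳ S₁ (here refl)

  y∈P : y ∈ S₁ ++ x ∷ y ∷ S₂
  y∈P = ∈-++⁺ʳ S₁ (there (here refl))

  in-M₀ : ∀ {w} → w ∈ S₁ ++ x ∷ y ∷ S₂ → w ∈ M₀
  in-M₀ w∈P = All.lookup L⊆M₀ (∈-resp-↭ P↭L w∈P)

  x≢y : side x ≢ side y
  x≢y e = true≢false (trans (trans (sym (dec-true (x ∈? A) (∈-++⁺ʳ S₁ (here refl)))) e)
                            (dec-false (y ∈? A) y∉A))
    where
    y∉A : y ∉ A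
    y∉A y∈A = unique-disjoint A (subst Unique P≡A++B uniqueP) y∈A (here refl)

  straddle : ∀ {u v} → u ∈ L → v ∈ L → side u ≢ side v → meet u v ⊑ meet x y
  straddle {u} {v} u∈L v∈L u≢v with side u in su | side v in sv
  ... | true | false = cut-meet S₁ coP (in-A su) (in-B v∈L sv)
  ... | false | true = subst (_⊑ meet x y) (meet-comm v u) (cut-meet S₁ coP (in-A sv) (in-B u∈L su))
  ... | true | true = ⊥-elim (u≢v refl)
  ... | false | false = ⊥-elim (u≢v refl)

  via : ∀ {a b} → Crossing side M₀ a b → meet a b ≡ meet x y → meet x y ∈ L
  via (crossing T₁ z z' T₂ split before after changes) ab≡xy =
    subst (_∈ L) (sym xy≡zz') (harmonious-meet-∈ z∈L z'∈L harmonious)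
    where
    z∈L : z ∈ L
    z∈L = All.lookup M₀⊆L (subst (z ∈_) (sym split) (∈-++⁺ʳ T₁ (here refl)))
    z'∈L : z' ∈ L
    z'∈L = All.lookup M₀⊆L (subst (z' ∈_) (sym split) (∈-++⁺ʳ T₁ (there (here refl))))
    harmonious : ¬ Inharmonious z z'
    harmonious = linked-at T₁ (subst (Linked _) split M₀-harmonious)
    xy≡zz' : meet x y ≡ meet z z'
    xy≡zz' = ⊑-antisym (subst (_⊑ meet z z') ab≡xy (cut-meet T₁ (subst CO split M₀-co) before after))
                       (straddle z∈L z'∈L changes)

-- Inserting meets preserves CO: each row undergoes the bitwise insertion.
CO-insertMeets : ∀ {k} (M : Matrix k) → CO M → CO (insertMeets meet M)
CO-insertMeets M co i =
  interval⇒contiguous _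
    (subst Interval (sym row-commutes) (Interval-insertMeets (contiguous⇒interval _ (co i))))
  where
  row-commutes : row i (insertMeets meet M) ≡ insertMeets _∧_ (row i M)
  row-commutes = map-insertMeets (λ c → lookup c i) (λ u v → lookup-meet u v i) M

harmonious-insertMeets : ∀ {k} (M : Matrix k) → Linked (λ u v → ¬ Inharmonious u v) (insertMeets meet M)
harmonious-insertMeets = Linked-insertMeets meet
  (λ x y → comparable⇒harmonious x (meet x y) (inj₂ (meet-⊑ˡ x y)))
  (λ x y → comparable⇒harmonious (meet x y) y (inj₁ (meet-⊑ʳ x y)))

proposition3p9 : (k : ℕ) (L : Matrix k) → Unique L →
    Σ (Matrix k) (λ M → IsMultiordering L M × HCO M) →
    (P : Matrix k) → IsOrdering L P → CO P →
    Σ (Matrix k) (λ M → P ⊆ M × IsMultiordering L M × HCO M)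
proposition3p9 k L uniqueL (M₀ , M₀-multi , M₀-hco) P P↭L coP =
  insertMeets meet P ,
  P⊆M ,
  (All-insertMeets meet P⊆L adjacent-meets , All.map (Sublist.lookup P⊆M) L⊆P) ,
  CO-insertMeets P coP ,
  harmonious-insertMeets P
  where
  P⊆M : P ⊆ insertMeets meet P
  P⊆M = ⊆-insertMeets meet P
  P⊆L : All (_∈ L) P
  P⊆L = All.tabulate (∈-resp-↭ P↭L)
  L⊆P : All (_∈ P) L
  L⊆P = All.tabulate (∈-resp-↭ (↭-sym P↭L))
  uniqueP : Unique P
  uniqueP = Unique-resp-↭ (setoid _) (↭⇒↭ₛ (↭-sym P↭L)) uniqueL
  adjacent-meets : Linked (λ x y → meet x y ∈ L) P
  adjacent-meets = linked-from-splits P (adjacent-meet-∈ M₀-multi M₀-hco P↭L uniqueP coP)
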